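{- If $G$ is a graph with minimum degree $\delta(G)$, then $\delta(G)+1\le \gamma'_{\rm SMB}(G)\le \gamma_{\rm SMB}(G)$.
   Context: All graphs are finite and simple; $N_G[v]$ is the closed neighborhood of $v$. The Maker-Breaker domination game on $G$ is played by Dominator and Staller, who alternately play a vertex not played before. Dominator wins if the set of vertices he has played is a dominating set of $G$; Staller wins if she has played all vertices of $N_G[v]$ for some $v\in V(G)$. In the D-game Dominator moves first, in the S-game Staller moves first. $\gamma_{\rm SMB}(G)$ (resp. $\gamma'_{\rm SMB}(G)$) is the smallest integer $k$ such that in the D-game (resp. S-game), under any strategy of Dominator, Staller can win having played at most $k$ vertices; the value is $\infty$ (larger than every integer, and $\infty\le\infty$) if Staller has no winning strategy. -}

module Defs where

open import Data.Nat using (ℕ; zero; suc; _≤_; _⊓_)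
open import Data.Bool using (Bool; true; false; not; _∧_; _∨_; if_then_else_)
open import Data.Fin using (Fin; _≟_)
import Data.Fin as Fin
open import Data.List using (List; filter; length; foldr)
open import Data.Bool.ListAction using (all; any)
open import Data.List using () renaming (map to mapL)
open import Data.Fin.Base using ()
open import Data.List.Base using ()
open import Relation.Nullary using (does)
open import Relation.Binary.PropositionalEquality using (_≡_)

record Graph (n : ℕ) : Set where
  field
    adj   : Fin n → Fin n → Bool
    sym   : ∀ u v → adj u v ≡ adj v u
    irref : ∀ v → adj v v ≡ false
open Graph public

vertices : (n : ℕ) → List (Fin n)
vertices n = Data.List.allFin n
  where import Data.List

inN : ∀ {n} → Graph n → Fin n → Fin n → Bool
inN G v u = does (u ≟ v) ∨ adj G v u

degree : ∀ {n} → Graph n → Fin n → ℕ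
degree {n} G v = length (filter (λ u → adj G v u Data.Bool.≟ true) (vertices n))
  where import Data.Bool

δ : ∀ {m} → Graph (suc m) → ℕ
δ {m} G = foldr (λ v r → degree G v ⊓ r) (degree G Fin.zero) (vertices (suc m))

VSet : ℕ → Set
VSet n = Fin n → Bool

∅ : ∀ {n} → VSet n
∅ _ = false

insert : ∀ {n} → Fin n → VSet n → VSet n
insert v S u = does (u ≟ v) ∨ S u

dominates : ∀ {n} → Graph n → VSet n → Bool
dominates {n} G D = all (λ v → any (λ u → inN G v u ∧ D u) (vertices n)) (vertices n)

containsNbhd : ∀ {n} → Graph n → VSet n → Bool
containsNbhd {n} G S = any (λ v → all (λ u → not (inN G v u) ∨ S u) (vertices n)) (vertices n)

data Player : Set where
  dominator staller : Player

-- stallerWins G fuel k D S p = true  iff, in the position where Dominator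
-- has played D, Staller has played S, and p is to move, Staller has a
-- strategy that wins (against every strategy of Dominator) while playing
-- at most k further vertices.  'fuel' bounds the number of remaining moves
-- (initially n, the number of vertices; every move plays a new vertex).
stallerWins : ∀ {n} → Graph n → ℕ → ℕ → VSet n → VSet n → Player → Bool
stallerWins G zero k D S p = containsNbhd G S
stallerWins {n} G (suc f) k D S p =
  if containsNbhd G S then true else
  if dominates G D then false else move p k
  where
  unplayed : Fin n → Bool
  unplayed v = not (D v) ∧ not (S v)
  move : Player → ℕ → Bool
  move staller zero = false
  move staller (suc k') =
    any (λ v → unplayed v ∧ stallerWins G f k' D (insert v S) dominator) (vertices n)
  move dominator k =
    all (λ v → not (unplayed v) ∨ stallerWins G f k (insert v D) S staller) (vertices n)

StallerWinsWithin : ∀ {n} → Graph n → Player → ℕ → Bool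
StallerWinsWithin {n} G p k = stallerWins G n k ∅ ∅ p

data ℕ∞ : Set where
  fin : ℕ → ℕ∞
  ∞   : ℕ∞

data _≤∞_ : ℕ∞ → ℕ∞ → Set where
  fin≤fin : ∀ {a b} → a ≤ b → fin a ≤∞ fin b
  x≤∞     : ∀ {x} → x ≤∞ ∞

leastFrom : (ℕ → Bool) → ℕ → ℕ → ℕ∞
leastFrom P i zero = if P i then fin i else ∞
leastFrom P i (suc r) = if P i then fin i else leastFrom P (suc i) r

-- Staller never plays more than n vertices, so the least k is ≤ n if it exists.
γSMBfrom : ∀ {n} → Graph n → Player → ℕ∞
γSMBfrom {n} G p = leastFrom (StallerWinsWithin G p) 0 n

γSMB : ∀ {n} → Graph n → ℕ∞
γSMB G = γSMBfrom G dominator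

γ'SMB : ∀ {n} → Graph n → ℕ∞
γ'SMB G = γSMBfrom G staller

-- Lower bound: Staller can only have won once some closed neighbourhood N[w] is entirely hers, and each
-- of her moves claims one vertex; so from any position she wins within k moves, some N[w] has at most k
-- vertices not yet hers. In the empty position each N[w] has deg w + 1 ≥ δ + 1 such vertices.
-- S-game vs D-game: Staller opens by pretending Dominator already made a first move and follows her D-game
-- strategy against this imagined Dominator. Claiming fewer vertices never helps Dominator, and whenever
-- the real Dominator takes a vertex the imagined one already owns, the imagined one takes any free vertex.
module Submission where

open import Defs
open import Data.Nat using (ℕ; zero; suc; _≤_; z≤n; s≤s; _⊓_)
open import Data.Nat.Properties using (≤-refl; ≤-trans; ≤-reflexive; m≤n⇒m≤1+n; n≤1+n; <⇒≤; m⊓n≤m; m⊓n≤n; module ≤-Reasoning)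
open import Data.Bool using (Bool; true; false; T; not; _∧_; _∨_; if_then_else_)
open import Data.Bool.Properties using (T-∧)
open import Data.Bool.ListAction using (all; any)
open import Data.Fin using (Fin; zero; suc; _≟_)
open import Data.Fin.Properties using (¬∀⟶∃¬; any?)
open import Data.List using (_∷_; filter; length; foldr; tabulate; allFin)
import Data.List.Relation.Unary.All.Properties as All
import Data.List.Relation.Unary.Any.Properties as Any
open import Data.List.Membership.Propositional using (_∈_)
open import Data.List.Membership.Propositional.Properties using (∈-allFin)
open import Data.List.Relation.Unary.Any using (here; there)
open import Data.Product using (_×_; _,_; ∃; proj₁; proj₂)
open import Data.Sum using (_⊎_; inj₁; inj₂; map₂)
open import Data.Unit using (tt)
open import Data.Empty using (⊥-elim)
open import Function using (_∘_; _⇔_; mk⇔; module Equivalence)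
open Equivalence using (to; from)
open import Relation.Nullary using (¬_; yes; no; does)
open import Relation.Nullary.Decidable using (T?)
open import Relation.Binary.PropositionalEquality using (_≡_; refl; cong)

T-not-∨ : ∀ {a b} → T (not a ∨ b) ⇔ (T a → T b)
T-not-∨ {true}  = mk⇔ (λ b _ → b) (λ f → f tt)
T-not-∨ {false} = mk⇔ (λ _ ()) (λ _ → tt)

T-if : ∀ c d m → T (if c then true else (if d then false else m)) ⇔ (T c ⊎ (¬ T d × T m))
T-if true  d     m = mk⇔ inj₁ (λ _ → tt)
T-if false true  m = mk⇔ (λ ()) λ { (inj₁ ()) ; (inj₂ (¬d , _)) → ¬d tt }
T-if false false m = mk⇔ (λ x → inj₂ ((λ ()) , x)) λ { (inj₁ ()) ; (inj₂ (_ , x)) → x }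

all-allFin : ∀ {n} {p : Fin n → Bool} → T (all p (allFin n)) ⇔ (∀ v → T (p v))
all-allFin {p = p} = mk⇔ (All.tabulate⁻ ∘ All.all⁺ p _) (All.all⁻ p ∘ All.tabulate⁺)

any-allFin : ∀ {n} {p : Fin n → Bool} → T (any p (allFin n)) ⇔ ∃ (T ∘ p)
any-allFin {p = p} = mk⇔ (Any.tabulate⁻ ∘ Any.any⁻ p _) (λ (v , pv) → Any.any⁺ p (Any.tabulate⁺ v pv))

foldr-⊓-≤ : ∀ {A : Set} (g : A → ℕ) z {xs x} → x ∈ xs → foldr (λ v r → g v ⊓ r) z xs ≤ g x
foldr-⊓-≤ g z {y ∷ _} (here refl) = m⊓n≤m (g y) _
foldr-⊓-≤ g z {y ∷ _} (there x∈xs) = ≤-trans (m⊓n≤n (g y) _) (foldr-⊓-≤ g z x∈xs)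

module _ {n : ℕ} where

  infix 4 _⊆_
  _⊆_ : VSet n → VSet n → Set
  A ⊆ B = ∀ u → T (A u) → T (B u)

  infixl 6 _∖_
  _∖_ : VSet n → VSet n → VSet n
  (A ∖ B) u = A u ∧ not (B u)

  insert-mono : ∀ v {A B} → A ⊆ B → insert v A ⊆ insert v B
  insert-mono v A⊆B u with does (u ≟ v)
  ... | true  = λ _ → tt
  ... | false = A⊆B u

  insert-absorb : ∀ {v w A B} → A ⊆ B → T (B v) → insert v A ⊆ insert w B
  insert-absorb {v} {w} {A} {B} A⊆B Bv u with u ≟ v | does (u ≟ w)
  ... | yes refl | true  = λ _ → tt
  ... | yes refl | false = λ _ → Bv
  ... | no _     | true  = λ _ → tt
  ... | no _     | false = A⊆B u

  insert-redundant : ∀ v A → T (A v) → insert v A ⊆ A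
  insert-redundant v A Av u with u ≟ v
  ... | yes refl = λ _ → Av
  ... | no _     = λ x → x

  ∖-insert : ∀ v A S → A ∖ S ⊆ insert v (A ∖ insert v S)
  ∖-insert v A S u with does (u ≟ v)
  ... | true  = λ _ → tt
  ... | false = λ x → x

  ⊆-∖-∅ : ∀ A → A ⊆ A ∖ ∅
  ⊆-∖-∅ A u with A u
  ... | true  = λ _ → tt
  ... | false = λ ()

count : ∀ {n} → VSet n → ℕ
count {zero}  A = 0
count {suc n} A = if A zero then suc (count (A ∘ suc)) else count (A ∘ suc)

count-mono : ∀ {n} {A B : VSet n} → A ⊆ B → count A ≤ count B
count-mono {zero} _ = z≤n
count-mono {suc n} {A} {B} A⊆B with A zero | B zero | A⊆B zero
... | true  | true  | _   = s≤s (count-mono (A⊆B ∘ suc))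
... | true  | false | A→B = ⊥-elim (A→B tt)
... | false | true  | _   = m≤n⇒m≤1+n (count-mono (A⊆B ∘ suc))
... | false | false | _   = count-mono (A⊆B ∘ suc)

count-∅ : ∀ {n} {A : VSet n} → (∀ u → ¬ T (A u)) → count A ≡ 0
count-∅ {zero} _ = refl
count-∅ {suc n} {A} ¬A with A zero | ¬A zero
... | true  | ¬A₀ = ⊥-elim (¬A₀ tt)
... | false | _   = count-∅ (¬A ∘ suc)

count-insert : ∀ {n} v {A : VSet n} → ¬ T (A v) → count (insert v A) ≡ suc (count A)
count-insert zero    {A} ¬Av with A zero
... | true  = ⊥-elim (¬Av tt)
... | false = refl
count-insert (suc v) {A} ¬Av with A zero
... | true  = cong suc (count-insert v ¬Av)
... | false = count-insert v ¬Av

count-insert-≤ : ∀ {n} v (A : VSet n) → count (insert v A) ≤ suc (count A)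
count-insert-≤ v A with T? (A v)
... | yes Av = m≤n⇒m≤1+n (count-mono (insert-redundant v A Av))
... | no ¬Av = ≤-reflexive (count-insert v ¬Av)

length-filter-tabulate : ∀ {n m} (A : VSet m) (f : Fin n → Fin m) →
  length (filter (λ u → A u Data.Bool.≟ true) (tabulate f)) ≡ count (A ∘ f)
length-filter-tabulate {zero} A f = refl
length-filter-tabulate {suc n} A f with A (f zero)
... | true  = cong suc (length-filter-tabulate A (f ∘ suc))
... | false = length-filter-tabulate A (f ∘ suc)

module _ {n : ℕ} (G : Graph n) where

  degree≡count : ∀ w → degree G w ≡ count (adj G w)
  degree≡count w = length-filter-tabulate (adj G w) (λ u → u)

  dominates⇔ : ∀ {D} → T (dominates G D) ⇔ (∀ v → ∃ λ u → T (inN G v u ∧ D u))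
  dominates⇔ = mk⇔ (λ d v → to any-allFin (to all-allFin d v))
                   (λ d → from all-allFin (from any-allFin ∘ d))

  containsNbhd⇔ : ∀ {S} → T (containsNbhd G S) ⇔ ∃ λ v → inN G v ⊆ S
  containsNbhd⇔ = mk⇔
    (λ c → let (v , N⊆S) = to any-allFin c
           in v , λ u → to T-not-∨ (to all-allFin N⊆S u))
    (λ (v , N⊆S) → from any-allFin
                     (v , from all-allFin (from T-not-∨ ∘ N⊆S)))

  dominates-mono : ∀ {D D'} → D ⊆ D' → T (dominates G D) → T (dominates G D')
  dominates-mono D⊆D' d = from dominates⇔ λ v →
    let (u , NDu) = to dominates⇔ d v
        (Nu , Du) = to T-∧ NDu
    in u , from T-∧ (Nu , D⊆D' u Du)

  unplayed : VSet n → VSet n → VSet n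
  unplayed D S v = not (D v) ∧ not (S v)

  unplayed-anti : ∀ {D D'} S v → D ⊆ D' → T (unplayed D' S v) → T (unplayed D S v)
  unplayed-anti {D} {D'} S v D⊆D' with D v | D' v | D⊆D' v
  ... | false | false | _    = λ x → x
  ... | false | true  | _    = λ ()
  ... | true  | false | D→D' = ⊥-elim (D→D' tt)
  ... | true  | true  | _    = λ ()

  -- With no vertex left, a vertex undominated by D has its whole closed neighbourhood in S.
  full-board : ∀ {D S} → ¬ T (dominates G D) → T (containsNbhd G S) ⊎ ∃ (T ∘ unplayed D S)
  full-board {D} {S} ¬dom with any? (T? ∘ unplayed D S)
  ... | yes free = inj₂ free
  ... | no ¬free = inj₁ (from containsNbhd⇔ (v , N⊆S))
    where
    undominated : ∃ λ v → ¬ T (any (λ u → inN G v u ∧ D u) (allFin n))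
    undominated = ¬∀⟶∃¬ n _ (λ v → T? _) (¬dom ∘ from all-allFin)
    v = proj₁ undominated
    claimed-by-S : ∀ d s → ¬ T d → ¬ T (not d ∧ not s) → T s
    claimed-by-S true  _     ¬d _   = ⊥-elim (¬d tt)
    claimed-by-S false true  _  _   = tt
    claimed-by-S false false _  ¬fr = ⊥-elim (¬fr tt)
    N⊆S : inN G v ⊆ S
    N⊆S u Nu = claimed-by-S (D u) (S u)
      (λ Du → proj₂ undominated (from any-allFin (u , from T-∧ (Nu , Du))))
      (λ fr → ¬free (u , fr))

  imagined-reply : ∀ {D D'} S v → D ⊆ D' → ¬ T (dominates G D') → T (unplayed D S v) →
                   T (containsNbhd G S) ⊎ ∃ λ u → T (unplayed D' S u) × insert v D ⊆ insert u D'
  imagined-reply {D} {D'} S v D⊆D' ¬dom' free with T? (D' v)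
  ... | yes D'v = map₂ (λ (u , fr) → u , fr , insert-absorb D⊆D' D'v) (full-board ¬dom')
  ... | no ¬D'v = inj₂ (v , free' , insert-mono v D⊆D')
    where
    free' : T (unplayed D' S v)
    free' with D' v | S v
    ... | true  | _ = ⊥-elim (¬D'v tt)
    ... | false | _ = proj₂ (to T-∧ free)

  missing : Fin n → VSet n → ℕ
  missing w S = count (inN G w ∖ S)

  missing-insert : ∀ w v S → missing w S ≤ suc (missing w (insert v S))
  missing-insert w v S = ≤-trans (count-mono (∖-insert v (inN G w) S)) (count-insert-≤ v _)

  missing-∅ : ∀ w → suc (degree G w) ≤ missing w ∅
  missing-∅ w = begin
    suc (degree G w)      ≡⟨ cong suc (degree≡count w) ⟩
    suc (count (adj G w)) ≡⟨ count-insert w ¬adj-ww ⟨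
    count (inN G w)       ≤⟨ count-mono (⊆-∖-∅ (inN G w)) ⟩
    missing w ∅           ∎
    where
    open ≤-Reasoning
    ¬adj-ww : ¬ T (adj G w w)
    ¬adj-ww rewrite irref G w = λ ()

  containsNbhd⇒missing≤ : ∀ {S k} → T (containsNbhd G S) → ∃ λ w → missing w S ≤ k
  containsNbhd⇒missing≤ c = let (w , N⊆S) = to containsNbhd⇔ c in
    w , ≤-trans (≤-reflexive (count-∅ (λ u N∖S → let (Nu , ¬Su) = to T-∧ N∖S in
                                                    contradictory (N⊆S u Nu) ¬Su))) z≤n
    where
    contradictory : ∀ {s} → T s → ¬ T (not s)
    contradictory {true} _ ()

module _ {n : ℕ} (G : Graph n) where

  -- A record rather than T (stallerWins …), so that a proof determines the position it is about.
  record Wins (f k : ℕ) (D S : VSet n) (p : Player) : Set where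
    constructor won
    field wins : T (stallerWins G f k D S p)

  wins-of-containsNbhd : ∀ {f k D S p} → T (containsNbhd G S) → Wins f k D S p
  wins-of-containsNbhd {zero}  c = won c
  wins-of-containsNbhd {suc f} {D = D} {S} c =
    won (from (T-if (containsNbhd G S) (dominates G D) _) (inj₁ c))

  staller-wins-without-budget : ∀ {f D S} → Wins f 0 D S staller → T (containsNbhd G S)
  staller-wins-without-budget {zero} (won w) = w
  staller-wins-without-budget {suc f} {D} {S} (won w)
    with to (T-if (containsNbhd G S) (dominates G D) false) w
  ... | inj₁ c       = c
  ... | inj₂ (_ , ())

  staller-wins⁻ : ∀ {f k D S} → Wins (suc f) (suc k) D S staller →
    T (containsNbhd G S) ⊎
    (¬ T (dominates G D) × ∃ λ v → T (unplayed G D S v) × Wins f k D (insert v S) dominator)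
  staller-wins⁻ {D = D} {S} (won w) with to (T-if (containsNbhd G S) (dominates G D) _) w
  ... | inj₁ c        = inj₁ c
  ... | inj₂ (¬d , m) = let (v , free∧w) = to any-allFin m
                            (free , w') = to T-∧ free∧w
                        in inj₂ (¬d , v , free , won w')

  staller-wins⁺ : ∀ {f k D S} v → ¬ T (dominates G D) → T (unplayed G D S v) →
    Wins f k D (insert v S) dominator → Wins (suc f) (suc k) D S staller
  staller-wins⁺ {D = D} {S} v ¬d free (won w) = won (from (T-if (containsNbhd G S) (dominates G D) _)
    (inj₂ (¬d , from any-allFin (v , from T-∧ (free , w)))))

  dominator-wins⁻ : ∀ {f k D S} → Wins (suc f) k D S dominator →
    T (containsNbhd G S) ⊎
    (¬ T (dominates G D) × (∀ v → T (unplayed G D S v) → Wins f k (insert v D) S staller))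
  dominator-wins⁻ {D = D} {S} (won w) with to (T-if (containsNbhd G S) (dominates G D) _) w
  ... | inj₁ c        = inj₁ c
  ... | inj₂ (¬d , m) = inj₂ (¬d , λ v free → won (to T-not-∨ (to all-allFin m v) free))

  dominator-wins⁺ : ∀ {f k D S} → ¬ T (dominates G D) →
    (∀ v → T (unplayed G D S v) → Wins f k (insert v D) S staller) → Wins (suc f) k D S dominator
  dominator-wins⁺ {D = D} {S} ¬d w = won (from (T-if (containsNbhd G S) (dominates G D) _)
    (inj₂ (¬d , from all-allFin (λ v → from T-not-∨ (Wins.wins ∘ w v)))))

  wins⇒missing≤budget : ∀ {f k D S p} → Wins f k D S p → ∃ λ w → missing G w S ≤ k
  wins⇒missing≤budget {zero} (won c) = containsNbhd⇒missing≤ G c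
  wins⇒missing≤budget {suc f} {zero} {p = staller} w =
    containsNbhd⇒missing≤ G (staller-wins-without-budget w)
  wins⇒missing≤budget {suc f} {suc k} {S = S} {staller} w with staller-wins⁻ w
  ... | inj₁ c = containsNbhd⇒missing≤ G c
  ... | inj₂ (_ , v , _ , w') with wins⇒missing≤budget w'
  ...   | x , le = x , ≤-trans (missing-insert G x v S) (s≤s le)
  wins⇒missing≤budget {suc f} {p = dominator} w with dominator-wins⁻ w
  ... | inj₁ c = containsNbhd⇒missing≤ G c
  ... | inj₂ (¬d , w') with full-board G ¬d
  ...   | inj₁ c           = containsNbhd⇒missing≤ G c
  ...   | inj₂ (u , free) = wins⇒missing≤budget (w' u free)

  wins-mono : ∀ {f f'} k {D D'} S p → f ≤ f' → D ⊆ D' → Wins f k D' S p → Wins f' k D S p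
  wins-mono {zero} k S p _ _ (won w) = wins-of-containsNbhd w
  wins-mono {suc f} {suc f'} zero S staller _ _ w = wins-of-containsNbhd (staller-wins-without-budget w)
  wins-mono {suc f} {suc f'} (suc k) {D} {D'} S staller (s≤s f≤f') D⊆D' w with staller-wins⁻ w
  ... | inj₁ c = wins-of-containsNbhd c
  ... | inj₂ (¬d' , v , free , w') =
    staller-wins⁺ v (¬d' ∘ dominates-mono G D⊆D') (unplayed-anti G S v D⊆D' free)
      (wins-mono k (insert v S) dominator f≤f' D⊆D' w')
  wins-mono {suc f} {suc f'} k {D} {D'} S dominator (s≤s f≤f') D⊆D' w with dominator-wins⁻ w
  ... | inj₁ c = wins-of-containsNbhd c
  ... | inj₂ (¬d' , w') = dominator-wins⁺ (¬d' ∘ dominates-mono G D⊆D') reply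
    where
    reply : ∀ v → T (unplayed G D S v) → Wins f' k (insert v D) S staller
    reply v free with imagined-reply G S v D⊆D' ¬d' free
    ... | inj₁ c = wins-of-containsNbhd c
    ... | inj₂ (u , free' , vD⊆uD') = wins-mono k S staller f≤f' vD⊆uD' (w' u free')

leastFrom-lower-bound : ∀ P {b} i r → (∀ k → i ≤ k → T (P k) → b ≤ k) → fin b ≤∞ leastFrom P i r
leastFrom-lower-bound P i zero h with P i | h i ≤-refl
... | true  | b≤i = fin≤fin (b≤i tt)
... | false | _   = x≤∞
leastFrom-lower-bound P i (suc r) h with P i | h i ≤-refl
... | true  | b≤i = fin≤fin (b≤i tt)
... | false | _   = leastFrom-lower-bound P (suc i) r (λ k i<k → h k (<⇒≤ i<k))

leastFrom-anti-mono : ∀ P Q i r → (∀ k → T (P k) → T (Q k)) → leastFrom Q i r ≤∞ leastFrom P i r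
leastFrom-anti-mono P Q i zero P⇒Q with P i | Q i | P⇒Q i
... | true  | true  | _   = fin≤fin ≤-refl
... | true  | false | P→Q = ⊥-elim (P→Q tt)
... | false | _     | _   = x≤∞
leastFrom-anti-mono P Q i (suc r) P⇒Q with P i | Q i | P⇒Q i
... | true  | true  | _   = fin≤fin ≤-refl
... | true  | false | P→Q = ⊥-elim (P→Q tt)
... | false | true  | _   = leastFrom-lower-bound P (suc i) r (λ k i<k _ → <⇒≤ i<k)
... | false | false | _   = leastFrom-anti-mono P Q (suc i) r P⇒Q

module _ {m : ℕ} (G : Graph (suc m)) where

  δ≤degree : ∀ w → δ G ≤ degree G w
  δ≤degree w = foldr-⊓-≤ (degree G) (degree G zero) (∈-allFin w)

  StallerWinsWithin⇔Wins : ∀ p k → T (StallerWinsWithin G p k) ⇔ Wins G (suc m) k ∅ ∅ p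
  StallerWinsWithin⇔Wins p k = mk⇔ (λ w → won w) Wins.wins

  staller-needs-more-than-δ : ∀ k → T (StallerWinsWithin G staller k) → suc (δ G) ≤ k
  staller-needs-more-than-δ k w =
    let (x , missing≤k) = wins⇒missing≤budget G (to (StallerWinsWithin⇔Wins staller k) w)
    in ≤-trans (s≤s (δ≤degree x)) (≤-trans (missing-∅ G x) missing≤k)

  staller-wins-S-game-of-D-game : ∀ k → T (StallerWinsWithin G dominator k) → T (StallerWinsWithin G staller k)
  staller-wins-S-game-of-D-game k w
    with dominator-wins⁻ G (to (StallerWinsWithin⇔Wins dominator k) w)
  ... | inj₁ c        = from (StallerWinsWithin⇔Wins staller k) (wins-of-containsNbhd G c)
  ... | inj₂ (_ , w') = from (StallerWinsWithin⇔Wins staller k)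
                          (wins-mono G k ∅ staller (n≤1+n m) (λ _ ()) (w' zero tt))

proposition2p7 : ∀ {m} (G : Graph (suc m)) → fin (suc (δ G)) ≤∞ γ'SMB G × γ'SMB G ≤∞ γSMB G
proposition2p7 {m} G =
  leastFrom-lower-bound (StallerWinsWithin G staller) 0 (suc m) (λ k _ → staller-needs-more-than-δ G k) ,
  leastFrom-anti-mono (StallerWinsWithin G dominator) (StallerWinsWithin G staller) 0 (suc m)
    (staller-wins-S-game-of-D-game G)
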